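{- Let $p$ be an odd prime and $n>3$ an odd integer such that $n+1\neq 2l_1p$ for every positive integer $l_1$ and $n\neq p^{l_2}$ for every positive integer $l_2$. Let $$f_{n,1}(x)=\sum_{j\geq 0}\binom{n-1}{2j+1}(x^j-x^{j+1})+2\sum_{j\geq 0}\binom{n}{2j}x^j\in\mathbb{F}_p[x],\qquad C_n(x):=f_{n,1}(x)-(n+1)x^{(n-1)/2}.$$ Then, with $N=(n-1)/2$, $C_n(x)$ viewed as an element of $\mathbb{F}_p[x]/(x^N-1)$ is a coterm polynomial.
   Context: Coefficients are reduced modulo $p$; binomial coefficients $\binom{a}{b}$ are $0$ when $b>a$. For a commutative ring $R$ with identity and $N\ge1$, a polynomial $a_0+a_1x+\cdots+a_{N-1}x^{N-1}\in R[x]/(x^N-1)$ is a coterm polynomial if $a_i=a_{N-i}$ for all $1\le i\le\lfloor N/2\rfloor$. -}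

module Defs where

open import Data.Nat using (ℕ; zero; suc; _≡ᵇ_; _∸_; _/_)
import Data.Nat as ℕ
open import Data.Nat.Combinatorics using (_C_)
open import Data.Integer using (ℤ; +_; -_; _-_; 0ℤ; 1ℤ)
import Data.Integer as ℤ
open import Data.Integer.Divisibility using (_∣_)
open import Data.List using (List; []; _∷_; replicate; _++_; upTo; foldr; map)
open import Data.Bool using (if_then_else_)

-- Polynomials with integer coefficients, as coefficient lists (constant term first).
-- Coefficients are read modulo p (i.e. in F_p) via the congruence _≡[_]_ below.
Poly : Set
Poly = List ℤ

infixl 6 _+ₚ_
_+ₚ_ : Poly → Poly → Poly
[]       +ₚ g        = g
(a ∷ f)  +ₚ []       = a ∷ f
(a ∷ f)  +ₚ (b ∷ g)  = (a ℤ.+ b) ∷ (f +ₚ g)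

mono : ℕ → ℤ → Poly
mono j c = replicate j 0ℤ ++ (c ∷ [])

sumₚ : List Poly → Poly
sumₚ = foldr _+ₚ_ []

bin : ℕ → ℕ → ℤ
bin a b = + (a C b)

half : ℕ → ℕ
half n = (n ∸ 1) / 2

-- f_{n,1}(x) = Σ_{j≥0} C(n-1,2j+1)(x^j - x^{j+1}) + 2 Σ_{j≥0} C(n,2j) x^j.
-- All terms with j > n vanish (the binomial coefficients are 0), so the
-- sums are taken over 0 ≤ j ≤ n.
fn1 : ℕ → Poly
fn1 n = sumₚ (map term (upTo (suc n)))
  where
  term : ℕ → Poly
  term j = mono j (bin (n ∸ 1) (2 ℕ.* j ℕ.+ 1))
             +ₚ mono (suc j) (- bin (n ∸ 1) (2 ℕ.* j ℕ.+ 1))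
             +ₚ mono j (+ 2 ℤ.* bin n (2 ℕ.* j))

Cn : ℕ → Poly
Cn n = fn1 n +ₚ mono (half n) (- (+ (suc n)))

-- Image in R[x]/(x^N - 1): the coefficient a_k (0 ≤ k < N) of the reduced
-- polynomial is the sum of the coefficients c_m with m ≡ k (mod N).
-- redAux N i f k: i is the current exponent reduced mod N (wrapping counter).
redAux : ℕ → ℕ → Poly → ℕ → ℤ
redAux N i []      k = 0ℤ
redAux N i (c ∷ f) k =
  (if i ≡ᵇ k then c else 0ℤ) ℤ.+ redAux N (if suc i ≡ᵇ N then 0 else suc i) f k

reduceMod : ℕ → Poly → ℕ → ℤ
reduceMod N f k = redAux N 0 f k

_≡[_]_ : ℤ → ℕ → ℤ → Set
a ≡[ p ] b = (+ p) ∣ (a - b)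

IsCoterm : ℕ → ℕ → (ℕ → ℤ) → Set
IsCoterm p N a = ∀ i → 1 ℕ.≤ i → i ℕ.≤ N / 2 → a i ≡[ p ] a (N ∸ i)

CotermMod : ℕ → ℕ → Poly → Set
CotermMod p N f = IsCoterm p N (reduceMod N f)

-- Write n = 2q + 1. Comparing coefficients and applying Pascal's rule twice, the
-- coefficient of x^k in C_n is C(2q+2, 2k+1) for every k ≥ 1 other than k = q;
-- in particular C_n has degree at most q = N, so reducing modulo x^N - 1 leaves
-- the coefficients of x^1, …, x^(N-1) untouched. The identity
-- C(2q+2, 2k+1) = C(2q+2, 2(q-k)+1) then makes them palindromic already over ℤ,
-- which is why no hypothesis on p, and none on n beyond oddness, is needed.
module Submission where

open import Defs
open import Data.Nat using (ℕ; zero; suc; _+_; _*_; _^_; _<_; _≤_; _%_; _≡ᵇ_; _∸_; _/_; z≤n; s≤s)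
open import Data.Nat.Primality using (Prime)
open import Relation.Binary.PropositionalEquality using (_≡_; _≢_)

open import Data.Bool using (true; false; if_then_else_; T)
open import Data.Integer as ℤ using (ℤ; +_; -_; 0ℤ)
import Data.Integer.Properties as ℤ
import Data.Integer.Tactic.RingSolver as ℤ-Solver
open import Data.List using ([]; _∷_; replicate; _++_; applyUpTo)
open import Data.List.Properties using (map-upTo)
open import Data.Nat.Combinatorics using (_C_; k>n⇒nCk≡0; nCk+nC[k+1]≡[n+1]C[k+1]; nCk≡nC[n∸k])
open import Data.Nat.Divisibility using (_∣0)
open import Data.Nat.DivMod using (m*n/n≡m; m/n<m; m≡m%n+[m/n]*n)
open import Data.Nat.Properties
import Data.Nat.Tactic.RingSolver as ℕ-Solver
open import Data.Unit using (tt)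
open import Relation.Nullary using (contradiction)
open import Relation.Binary.PropositionalEquality using (refl; sym; trans; cong; cong₂; subst; module ≡-Reasoning)

coeff : Poly → ℕ → ℤ
coeff []      m       = 0ℤ
coeff (c ∷ f) zero    = c
coeff (c ∷ f) (suc m) = coeff f m

shift : ℕ → Poly → Poly
shift i f = replicate i 0ℤ ++ f

coeff-+ₚ : ∀ f g m → coeff (f +ₚ g) m ≡ coeff f m ℤ.+ coeff g m
coeff-+ₚ []      g       m       = sym (ℤ.+-identityˡ _)
coeff-+ₚ (a ∷ f) []      m       = sym (ℤ.+-identityʳ _)
coeff-+ₚ (a ∷ f) (b ∷ g) zero    = refl
coeff-+ₚ (a ∷ f) (b ∷ g) (suc m) = coeff-+ₚ f g m

coeff-mono-≢ : ∀ {j m} c → j ≢ m → coeff (mono j c) m ≡ 0ℤ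
coeff-mono-≢ {zero}  {zero}  c j≢m = contradiction refl j≢m
coeff-mono-≢ {zero}  {suc m} c j≢m = refl
coeff-mono-≢ {suc j} {zero}  c j≢m = refl
coeff-mono-≢ {suc j} {suc m} c j≢m = coeff-mono-≢ c (λ j≡m → j≢m (cong suc j≡m))

coeff-shift-[] : ∀ i m → coeff (shift i []) m ≡ 0ℤ
coeff-shift-[] zero    m       = refl
coeff-shift-[] (suc i) zero    = refl
coeff-shift-[] (suc i) (suc m) = coeff-shift-[] i m

coeff-shift-< : ∀ {i m} f → m < i → coeff (shift i f) m ≡ 0ℤ
coeff-shift-< {suc i} {zero}  f _         = refl
coeff-shift-< {suc i} {suc m} f (s≤s m<i) = coeff-shift-< f m<i

coeff-shift-∷ : ∀ i c f m →
  coeff (shift i (c ∷ f)) m ≡ (if i ≡ᵇ m then c else 0ℤ) ℤ.+ coeff (shift (suc i) f) m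
coeff-shift-∷ zero    c f zero    = sym (ℤ.+-identityʳ c)
coeff-shift-∷ zero    c f (suc m) = sym (ℤ.+-identityˡ _)
coeff-shift-∷ (suc i) c f zero    = refl
coeff-shift-∷ (suc i) c f (suc m) = coeff-shift-∷ i c f m

redAux≡coeff-shift : ∀ {N k} → 1 ≤ k → k < N → ∀ f i → i < N →
  (∀ t → N < i + t → coeff f t ≡ 0ℤ) → redAux N i f k ≡ coeff (shift i f) k
redAux≡coeff-shift 1≤k k<N []      i i<N deg = sym (coeff-shift-[] i _)
redAux≡coeff-shift {N} {k} 1≤k k<N (c ∷ f) i i<N deg =
  trans (cong (λ r → (if i ≡ᵇ k then c else 0ℤ) ℤ.+ r) tail) (sym (coeff-shift-∷ i c f k))
  where
  tail : redAux N (if suc i ≡ᵇ N then 0 else suc i) f k ≡ coeff (shift (suc i) f) k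
  tail with suc i ≡ᵇ N in wraps
  ... | true  = begin
      redAux N 0 f k  ≡⟨ redAux≡coeff-shift 1≤k k<N f 0 (≤-<-trans z≤n k<N) deg-tail ⟩
      coeff f k       ≡⟨ deg (suc k) (subst (N <_) (sym i+1+k≡N+k) (m<m+n N 1≤k)) ⟩
      0ℤ              ≡⟨ sym (coeff-shift-< f (subst (k <_) (sym 1+i≡N) k<N)) ⟩
      coeff (shift (suc i) f) k ∎
    where
    open ≡-Reasoning
    1+i≡N : suc i ≡ N
    1+i≡N = ≡ᵇ⇒≡ (suc i) N (subst T (sym wraps) tt)
    i+1+k≡N+k : i + suc k ≡ N + k
    i+1+k≡N+k = trans (+-suc i k) (cong (_+ k) 1+i≡N)
    deg-tail : ∀ t → N < t → coeff f t ≡ 0ℤ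
    deg-tail t N<t = deg (suc t) (<-≤-trans N<t (≤-trans (n≤1+n t) (m≤n+m (suc t) i)))
  ... | false = redAux≡coeff-shift 1≤k k<N f (suc i) (≤∧≢⇒< i<N 1+i≢N) deg-tail
    where
    1+i≢N : suc i ≢ N
    1+i≢N 1+i≡N = subst T wraps (≡⇒≡ᵇ (suc i) N 1+i≡N)
    deg-tail : ∀ t → N < suc i + t → coeff f t ≡ 0ℤ
    deg-tail t N<1+i+t = deg (suc t) (subst (N <_) (sym (+-suc i t)) N<1+i+t)

reduceMod-coeff : ∀ {N k} f → 1 ≤ k → k < N → (∀ t → N < t → coeff f t ≡ 0ℤ) →
  reduceMod N f k ≡ coeff f k
reduceMod-coeff f 1≤k k<N deg = redAux≡coeff-shift 1≤k k<N f 0 (≤-<-trans z≤n k<N) deg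

≡⇒≡[_] : ∀ p {a b : ℤ} → a ≡ b → a ≡[ p ] b
≡⇒≡[ p ] {a} refl rewrite ℤ.+-inverseʳ a = p ∣0

isCoterm-of-palindromic : ∀ p N (a : ℕ → ℤ) →
  (∀ k → 1 ≤ k → k < N → a k ≡ a (N ∸ k)) → IsCoterm p N a
isCoterm-of-palindromic p zero      a palindromic (suc i) 1≤i ()
isCoterm-of-palindromic p N@(suc _) a palindromic i 1≤i i≤N/2 =
  ≡⇒≡[ p ] (palindromic i 1≤i (≤-<-trans i≤N/2 (m/n<m N 2 (s≤s (s≤s z≤n)))))

sumUpTo : ℕ → (ℕ → ℤ) → ℤ
sumUpTo zero    h = 0ℤ
sumUpTo (suc L) h = h 0 ℤ.+ sumUpTo L (λ j → h (suc j))

sumUpTo-cong : ∀ L {g h : ℕ → ℤ} → (∀ j → g j ≡ h j) → sumUpTo L g ≡ sumUpTo L h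
sumUpTo-cong zero    g≗h = refl
sumUpTo-cong (suc L) g≗h = cong₂ ℤ._+_ (g≗h 0) (sumUpTo-cong L (λ j → g≗h (suc j)))

sumUpTo-+ : ∀ L (g h : ℕ → ℤ) → sumUpTo L (λ j → g j ℤ.+ h j) ≡ sumUpTo L g ℤ.+ sumUpTo L h
sumUpTo-+ zero    g h = refl
sumUpTo-+ (suc L) g h = trans (cong (λ s → g 0 ℤ.+ h 0 ℤ.+ s) (sumUpTo-+ L _ _)) (interchange (g 0) (h 0) _ _)
  where
  interchange : ∀ a b c d → a ℤ.+ b ℤ.+ (c ℤ.+ d) ≡ a ℤ.+ c ℤ.+ (b ℤ.+ d)
  interchange = ℤ-Solver.solve-∀

sumUpTo-0 : ∀ L → sumUpTo L (λ _ → 0ℤ) ≡ 0ℤ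
sumUpTo-0 zero    = refl
sumUpTo-0 (suc L) = trans (ℤ.+-identityˡ _) (sumUpTo-0 L)

coeff-sumₚ : ∀ (P : ℕ → Poly) L m →
  coeff (sumₚ (applyUpTo P L)) m ≡ sumUpTo L (λ j → coeff (P j) m)
coeff-sumₚ P zero    m = refl
coeff-sumₚ P (suc L) m =
  trans (coeff-+ₚ (P 0) _ m) (cong (λ s → coeff (P 0) m ℤ.+ s) (coeff-sumₚ (λ j → P (suc j)) L m))

coeff-sum-mono : ∀ L (h : ℕ → ℤ) → (∀ j → L ≤ j → h j ≡ 0ℤ) →
  ∀ m → sumUpTo L (λ j → coeff (mono j (h j)) m) ≡ h m
coeff-sum-mono zero    h h≡0 m       = sym (h≡0 m z≤n)
coeff-sum-mono (suc L) h h≡0 zero    = trans (cong (λ s → h 0 ℤ.+ s) (sumUpTo-0 L)) (ℤ.+-identityʳ (h 0))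
coeff-sum-mono (suc L) h h≡0 (suc m) =
  trans (ℤ.+-identityˡ _) (coeff-sum-mono L (λ j → h (suc j)) (λ j L≤j → h≡0 (suc j) (s≤s L≤j)) m)

coeff-fn1 : ∀ n m → coeff (fn1 n) (suc m) ≡
  bin (n ∸ 1) (2 * suc m + 1) ℤ.+ - bin (n ∸ 1) (2 * m + 1) ℤ.+ + 2 ℤ.* bin n (2 * suc m)
coeff-fn1 n m = begin
  coeff (fn1 n) (suc m)
    ≡⟨ cong (λ ts → coeff (sumₚ ts) (suc m)) (map-upTo term (suc n)) ⟩
  coeff (sumₚ (applyUpTo term (suc n))) (suc m)
    ≡⟨ coeff-sumₚ term (suc n) (suc m) ⟩
  sumUpTo (suc n) (λ j → coeff (term j) (suc m))
    ≡⟨ sumUpTo-cong (suc n) coeff-term ⟩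
  sumUpTo (suc n) (λ j → A j ℤ.+ B j ℤ.+ G j)
    ≡⟨ sumUpTo-+ (suc n) (λ j → A j ℤ.+ B j) G ⟩
  sumUpTo (suc n) (λ j → A j ℤ.+ B j) ℤ.+ sumUpTo (suc n) G
    ≡⟨ cong (ℤ._+ sumUpTo (suc n) G) (sumUpTo-+ (suc n) A B) ⟩
  sumUpTo (suc n) A ℤ.+ sumUpTo (suc n) B ℤ.+ sumUpTo (suc n) G
    ≡⟨ cong₂ ℤ._+_ (cong₂ ℤ._+_ (coeff-sum-mono (suc n) β β-vanishes (suc m))
                                (coeff-sum-mono (suc n) (λ j → - β j) (λ j n<j → cong -_ (β-vanishes j n<j)) m))
                   (coeff-sum-mono (suc n) γ γ-vanishes (suc m)) ⟩
  β (suc m) ℤ.+ - β m ℤ.+ γ (suc m) ∎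
  where
  open ≡-Reasoning
  β γ : ℕ → ℤ
  β j = bin (n ∸ 1) (2 * j + 1)
  γ j = + 2 ℤ.* bin n (2 * j)
  term : ℕ → Poly
  term j = mono j (β j) +ₚ mono (suc j) (- β j) +ₚ mono j (γ j)
  A B G : ℕ → ℤ
  A j = coeff (mono j (β j)) (suc m)
  B j = coeff (mono j (- β j)) m
  G j = coeff (mono j (γ j)) (suc m)
  coeff-term : ∀ j → coeff (term j) (suc m) ≡ A j ℤ.+ B j ℤ.+ G j
  coeff-term j = trans (coeff-+ₚ (mono j (β j) +ₚ mono (suc j) (- β j)) _ (suc m))
                       (cong (ℤ._+ G j) (coeff-+ₚ (mono j (β j)) _ (suc m)))
  j≤2j : ∀ j → j ≤ 2 * j
  j≤2j j = m≤m+n j (j + 0)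
  β-vanishes : ∀ j → suc n ≤ j → β j ≡ 0ℤ
  β-vanishes j n<j = cong +_ (k>n⇒nCk≡0 (≤-<-trans (m∸n≤m n 1) (<-≤-trans n<j (≤-trans (j≤2j j) (m≤m+n _ 1)))))
  γ-vanishes : ∀ j → suc n ≤ j → γ j ≡ 0ℤ
  γ-vanishes j n<j = cong (λ c → + 2 ℤ.* + c) (k>n⇒nCk≡0 (<-≤-trans n<j (j≤2j j)))

pascal-twice : ∀ m a → m C (2 + a) + 2 * (suc m C suc a) ≡ (2 + m) C (2 + a) + m C a
pascal-twice m a = begin
  m C (2 + a) + 2 * (suc m C suc a)                      ≡⟨ cong (λ z → m C (2 + a) + 2 * z) (sym pascal₁) ⟩
  m C (2 + a) + 2 * (m C a + m C suc a)                  ≡⟨ regroup (m C a) (m C suc a) (m C (2 + a)) ⟩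
  (m C a + m C suc a) + (m C suc a + m C (2 + a)) + m C a ≡⟨ cong (_+ m C a) (trans (cong₂ _+_ pascal₁ pascal₂) pascal₃) ⟩
  (2 + m) C (2 + a) + m C a                              ∎
  where
  open ≡-Reasoning
  pascal₁ : m C a + m C suc a ≡ suc m C suc a
  pascal₁ = nCk+nC[k+1]≡[n+1]C[k+1] m a
  pascal₂ : m C suc a + m C (2 + a) ≡ suc m C (2 + a)
  pascal₂ = nCk+nC[k+1]≡[n+1]C[k+1] m (suc a)
  pascal₃ : suc m C suc a + suc m C (2 + a) ≡ (2 + m) C (2 + a)
  pascal₃ = nCk+nC[k+1]≡[n+1]C[k+1] (suc m) (suc a)
  regroup : ∀ y y′ x → x + 2 * (y + y′) ≡ (y + y′) + (y′ + x) + y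
  regroup = ℕ-Solver.solve-∀

pascal-twice-ℤ : ∀ m a →
  + (m C (2 + a)) ℤ.+ - + (m C a) ℤ.+ + 2 ℤ.* + (suc m C suc a) ≡ + ((2 + m) C (2 + a))
pascal-twice-ℤ m a = begin
  + X ℤ.+ - + Y ℤ.+ + 2 ℤ.* + Z   ≡⟨ move-right (+ X) (+ Y) (+ Z) ⟩
  (+ X ℤ.+ + 2 ℤ.* + Z) ℤ.- + Y   ≡⟨ cong (ℤ._- + Y) lifted ⟩
  (+ W ℤ.+ + Y) ℤ.- + Y           ≡⟨ cancel (+ W) (+ Y) ⟩
  + W                             ∎
  where
  open ≡-Reasoning
  X Y Z W : ℕ
  X = m C (2 + a)
  Y = m C a
  Z = suc m C suc a
  W = (2 + m) C (2 + a)
  lifted : + X ℤ.+ + 2 ℤ.* + Z ≡ + W ℤ.+ + Y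
  lifted = begin
    + X ℤ.+ + 2 ℤ.* + Z ≡⟨ cong (λ t → + X ℤ.+ t) (ℤ.pos-* 2 Z) ⟨
    + X ℤ.+ + (2 * Z)   ≡⟨ ℤ.pos-+ X (2 * Z) ⟨
    + (X + 2 * Z)       ≡⟨ cong +_ (pascal-twice m a) ⟩
    + (W + Y)           ≡⟨ ℤ.pos-+ W Y ⟩
    + W ℤ.+ + Y         ∎
  move-right : ∀ x y z → x ℤ.+ - y ℤ.+ + 2 ℤ.* z ≡ (x ℤ.+ + 2 ℤ.* z) ℤ.- y
  move-right = ℤ-Solver.solve-∀
  cancel : ∀ w y → (w ℤ.+ y) ℤ.- y ≡ w
  cancel = ℤ-Solver.solve-∀

binomial-odd-sym : ∀ {q k} → k ≤ q → (2 + 2 * q) C (2 * k + 1) ≡ (2 + 2 * q) C (2 * (q ∸ k) + 1)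
binomial-odd-sym {q} {k} k≤q = trans (nCk≡nC[n∸k] 2k+1≤2+2q) (cong ((2 + 2 * q) C_) complement)
  where
  2k≤2q : 2 * k ≤ 2 * q
  2k≤2q = *-monoʳ-≤ 2 k≤q
  2k+1≤2+2q : 2 * k + 1 ≤ 2 + 2 * q
  2k+1≤2+2q = ≤-trans (+-monoˡ-≤ 1 2k≤2q) (≤-trans (≤-reflexive (+-comm (2 * q) 1)) (n≤1+n _))
  complement : (2 + 2 * q) ∸ (2 * k + 1) ≡ 2 * (q ∸ k) + 1
  complement = begin
    (2 + 2 * q) ∸ (2 * k + 1) ≡⟨ cong ((2 + 2 * q) ∸_) (+-comm (2 * k) 1) ⟩
    (1 + 2 * q) ∸ 2 * k       ≡⟨ +-∸-assoc 1 2k≤2q ⟩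
    1 + (2 * q ∸ 2 * k)       ≡⟨ cong suc (sym (*-distribˡ-∸ 2 q k)) ⟩
    1 + 2 * (q ∸ k)           ≡⟨ +-comm 1 _ ⟩
    2 * (q ∸ k) + 1           ∎
    where open ≡-Reasoning

half-odd : ∀ q → half (suc (2 * q)) ≡ q
half-odd q = trans (cong (_/ 2) (*-comm 2 q)) (m*n/n≡m q 2)

coeff-Cn-odd : ∀ q {k} → 1 ≤ k → k ≢ q → coeff (Cn (suc (2 * q))) k ≡ + ((2 + 2 * q) C (2 * k + 1))
coeff-Cn-odd q {suc m} _ k≢q = begin
  coeff (Cn n) (suc m)
    ≡⟨ coeff-+ₚ (fn1 n) _ (suc m) ⟩
  coeff (fn1 n) (suc m) ℤ.+ coeff (mono (half n) (- + suc n)) (suc m)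
    ≡⟨ cong₂ ℤ._+_ (coeff-fn1 n m) (coeff-mono-≢ _ (λ q≡k → k≢q (trans (sym q≡k) (half-odd q)))) ⟩
  + (2 * q C (2 * suc m + 1)) ℤ.+ - + (2 * q C a) ℤ.+ + 2 ℤ.* + (n C (2 * suc m)) ℤ.+ 0ℤ
    ≡⟨ ℤ.+-identityʳ _ ⟩
  + (2 * q C (2 * suc m + 1)) ℤ.+ - + (2 * q C a) ℤ.+ + 2 ℤ.* + (n C (2 * suc m))
    ≡⟨ cong₂ (λ i j → + (2 * q C i) ℤ.+ - + (2 * q C a) ℤ.+ + 2 ℤ.* + (n C j)) index₁ index₂ ⟩
  + (2 * q C (2 + a)) ℤ.+ - + (2 * q C a) ℤ.+ + 2 ℤ.* + (n C suc a)
    ≡⟨ pascal-twice-ℤ (2 * q) a ⟩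
  + ((2 + 2 * q) C (2 + a))
    ≡⟨ cong (λ i → + ((2 + 2 * q) C i)) index₁ ⟨
  + ((2 + 2 * q) C (2 * suc m + 1)) ∎
  where
  open ≡-Reasoning
  n a : ℕ
  n = suc (2 * q)
  a = 2 * m + 1
  index₁ : 2 * suc m + 1 ≡ 2 + a
  index₁ = trans (cong (_+ 1) (*-suc 2 m)) (+-assoc 2 (2 * m) 1)
  index₂ : 2 * suc m ≡ suc a
  index₂ = trans (*-suc 2 m) (cong suc (+-comm 1 (2 * m)))

cotermMod-Cn-odd : ∀ p q → CotermMod p q (Cn (suc (2 * q)))
cotermMod-Cn-odd p q = isCoterm-of-palindromic p q (reduceMod q (Cn n)) palindromic
  where
  n : ℕ
  n = suc (2 * q)
  degree≤q : ∀ t → q < t → coeff (Cn n) t ≡ 0ℤ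
  degree≤q t q<t = trans (coeff-Cn-odd q (≤-trans (s≤s z≤n) q<t) (>⇒≢ q<t))
    (cong +_ (k>n⇒nCk≡0 (≤-<-trans 2+2q≤2t (m<m+n (2 * t) (s≤s z≤n)))))
    where
    2+2q≤2t : 2 + 2 * q ≤ 2 * t
    2+2q≤2t = subst (_≤ 2 * t) (*-suc 2 q) (*-monoʳ-≤ 2 q<t)
  reduced : ∀ k → 1 ≤ k → k < q → reduceMod q (Cn n) k ≡ + ((2 + 2 * q) C (2 * k + 1))
  reduced k 1≤k k<q = trans (reduceMod-coeff (Cn n) 1≤k k<q degree≤q) (coeff-Cn-odd q 1≤k (<⇒≢ k<q))
  palindromic : ∀ k → 1 ≤ k → k < q → reduceMod q (Cn n) k ≡ reduceMod q (Cn n) (q ∸ k)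
  palindromic k 1≤k k<q = begin
    reduceMod q (Cn n) k                  ≡⟨ reduced k 1≤k k<q ⟩
    + ((2 + 2 * q) C (2 * k + 1))         ≡⟨ cong +_ (binomial-odd-sym (<⇒≤ k<q)) ⟩
    + ((2 + 2 * q) C (2 * (q ∸ k) + 1))   ≡⟨ reduced (q ∸ k) (m<n⇒0<n∸m k<q) (∸-monoʳ-< 1≤k (<⇒≤ k<q)) ⟨
    reduceMod q (Cn n) (q ∸ k)            ∎
    where open ≡-Reasoning

odd≡1+2*half : ∀ n → n % 2 ≡ 1 → n ≡ suc (2 * half n)
odd≡1+2*half n n%2≡1 = trans n≡1+q*2 (cong suc (trans (*-comm q 2) (cong (2 *_) (sym half≡q))))
  where
  q : ℕ
  q = n / 2
  n≡1+q*2 : n ≡ suc (q * 2)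
  n≡1+q*2 = trans (m≡m%n+[m/n]*n n 2) (cong (_+ q * 2) n%2≡1)
  half≡q : half n ≡ q
  half≡q = trans (cong half n≡1+q*2) (m*n/n≡m q 2)

theorem5p11 : (p n : ℕ) → Prime p → p % 2 ≡ 1 → n % 2 ≡ 1 → 3 < n
    → (∀ l₁ → 1 ≤ l₁ → n + 1 ≢ 2 * l₁ * p)
    → (∀ l₂ → 1 ≤ l₂ → n ≢ p ^ l₂)
    → CotermMod p (half n) (Cn n)
theorem5p11 p n _ _ n-odd _ _ _ =
  subst (λ m → CotermMod p (half n) (Cn m)) (sym (odd≡1+2*half n n-odd)) (cotermMod-Cn-odd p (half n))
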